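{- Let $F$ be a clause-set. Consider the following game between Prover and Delayer on a partial assignment $\theta$, where always $\mathrm{var}(\theta)\subseteq\mathrm{var}(F)$. Initially $\theta$ is the empty assignment; the players move alternately, Delayer first. A move of Delayer replaces $\theta$ by any $\theta'\supseteq\theta$. A move of Prover replaces $\theta$ by some $\theta'\supsetneq\theta$ such that either $\theta'*F=\top$ or $\theta'$ assigns exactly one more variable than $\theta$. The game ends as soon as $\bot\in\theta*F$ or $\theta*F=\top$; in the first case Delayer receives as many points as variables have been assigned by Prover's moves, in the second case Delayer receives $0$ points. Then Delayer has a strategy that always achieves at least $\mathrm{hd}(F)$ points, and Prover has a strategy ensuring that Delayer never gets $\mathrm{hd}(F)+1$ or more points.
   Context: Literals are variables $v$ or negations $\overline{v}$; a clause is a finite set of literals without complementary pair; a clause-set is a finite set of clauses; $\bot$ is the empty clause, $\top$ the empty clause-set; $\mathrm{var}(F)$ is the set of variables of $F$. A partial assignment $\varphi$ maps a finite set $\mathrm{var}(\varphi)$ of variables to $\{0,1\}$; $\varphi*F$ removes clauses containing a literal made true and removes false literals from the other clauses. $F$ is unsatisfiable if no $\varphi$ gives $\varphi*F=\top$. Resolution: clauses $C,D$ with $C\cap\overline{D}=\{x\}$ (exactly one clash) have resolvent $(C\cup D)\setminus\{x,\overline{x}\}$. A resolution tree is a finite rooted tree in which every inner node has exactly two children, nodes are labelled by clauses, and each inner node's label is the resolvent of its children's labels; a refutation of $F$ is a resolution tree with all leaf labels in $F$ and root label $\bot$. The Horton–Strahler number $\mathrm{hts}(T)$ of a binary tree is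 $0$ for a single node, and for a root with subtrees $T_1,T_2$ it is $\mathrm{hts}(T_1)+1$ if $\mathrm{hts}(T_1)=\mathrm{hts}(T_2)$ and $\max(\mathrm{hts}(T_1),\mathrm{hts}(T_2))$ otherwise. For unsatisfiable $F$, the hardness $\mathrm{hd}(F)$ is the minimum of $\mathrm{hts}(T)$ over refutations $T$ of $F$. Extension to all clause-sets: $\mathrm{hd}(\top):=0$, and for $F\ne\top$, $\mathrm{hd}(F):=\max\{\mathrm{hd}(\varphi*F):\varphi*F\text{ unsatisfiable}\}$. -}

module Defs where

open import Data.Nat using (ℕ; zero; suc; _≤_; _⊔_; _≡ᵇ_)
open import Data.Bool using (Bool; true; false; not; if_then_else_)
open import Data.Product using (Σ; _×_; _,_; proj₁)
open import Data.Sum using (_⊎_)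
open import Data.Maybe using (Maybe; just; nothing)
open import Data.List using (List; []; _∷_; filterᵇ)
open import Data.Bool.ListAction using (any)
open import Data.List.Membership.Propositional using (_∈_; _∉_)
open import Data.List.Relation.Unary.Any using (Any)
import Data.Empty
open import Relation.Binary.PropositionalEquality using (_≡_; _≢_)

-- Literals, clauses, clause-sets
-- A variable is a natural number; a literal is (v , true) = v  or
-- (v , false) = negation of v.  Clauses and clause-sets are finite sets,
-- represented by lists (only membership matters).

Var : Set
Var = ℕ

Lit : Set
Lit = Var × Bool

neg : Lit → Lit
neg (v , b) = (v , not b)

Clause : Set
Clause = List Lit

CSet : Set
CSet = List Clause

IsClause : Clause → Set
IsClause C = ∀ l → l ∈ C → neg l ∉ C

IsClauseSet : CSet → Set
IsClauseSet F = ∀ C → C ∈ F → IsClause C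

_≈C_ : Clause → Clause → Set
C ≈C D = ∀ l → (l ∈ C → l ∈ D) × (l ∈ D → l ∈ C)

_∈var_ : Var → CSet → Set
v ∈var F = Any (λ C → Any (λ l → proj₁ l ≡ v) C) F

record PAss : Set where
  field
    val   : Var → Maybe Bool
    bound : ℕ
    fin   : ∀ v → bound ≤ v → val v ≡ nothing
open PAss public

emptyPA : PAss
emptyPA = record { val = λ _ → nothing ; bound = 0 ; fin = λ _ _ → _≡_.refl }

VarsIn : PAss → CSet → Set
VarsIn φ F = ∀ v → val φ v ≢ nothing → v ∈var F

_⊑_ : PAss → PAss → Set
φ ⊑ ψ = ∀ v b → val φ v ≡ just b → val ψ v ≡ just b

_⊏_ : PAss → PAss → Set
φ ⊏ ψ = (φ ⊑ ψ) × Σ Var (λ v → (val φ v ≡ nothing) × (val ψ v ≢ nothing))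

OneMore : PAss → PAss → Set
OneMore φ ψ = (φ ⊑ ψ) × Σ Var (λ v → (val φ v ≡ nothing) × (val ψ v ≢ nothing)
                                     × (∀ w → w ≢ v → val ψ w ≡ val φ w))

eqB : Bool → Bool → Bool
eqB true  true  = true
eqB false false = true
eqB _     _     = false

litTrue : PAss → Lit → Bool
litTrue φ (v , b) with val φ v
... | just c  = eqB c b
... | nothing = false

litFalse : PAss → Lit → Bool
litFalse φ (v , b) with val φ v
... | just c  = not (eqB c b)
... | nothing = false

_*_ : PAss → CSet → CSet
φ * []      = []
φ * (C ∷ F) = if any (litTrue φ) C
                then φ * F
                else filterᵇ (λ l → not (litFalse φ l)) C ∷ φ * F

IsTop : CSet → Set
IsTop G = G ≡ []

HasBot : CSet → Set
HasBot G = [] ∈ G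

Unsat : CSet → Set
Unsat G = ∀ φ → φ * G ≢ []

Resolvent : Clause → Clause → Clause → Set
Resolvent C D R =
  Σ Lit λ x → (x ∈ C) × (neg x ∈ D)
    × (∀ y → y ∈ C → neg y ∈ D → y ≡ x)
    × (∀ l → (l ∈ R → (l ∈ C ⊎ l ∈ D) × l ≢ x × l ≢ neg x)
           × ((l ∈ C ⊎ l ∈ D) × l ≢ x × l ≢ neg x → l ∈ R))

data RTree : Set where
  leaf : Clause → RTree
  node : Clause → RTree → RTree → RTree

label : RTree → Clause
label (leaf C)     = C
label (node C _ _) = C

htsNode : ℕ → ℕ → ℕ
htsNode a b = if a ≡ᵇ b then suc a else a ⊔ b

hts : RTree → ℕ
hts (leaf _)       = 0
hts (node _ T₁ T₂) = htsNode (hts T₁) (hts T₂)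

ValidTree : CSet → RTree → Set
ValidTree F (leaf C)       = Any (λ D → C ≈C D) F
ValidTree F (node C T₁ T₂) = Resolvent (label T₁) (label T₂) C × ValidTree F T₁ × ValidTree F T₂

Refutation : CSet → RTree → Set
Refutation F T = ValidTree F T × label T ≡ []

HdUnsat : CSet → ℕ → Set
HdUnsat G k = Unsat G × Σ RTree (λ T → Refutation G T × hts T ≡ k)
                      × (∀ T → Refutation G T → k ≤ hts T)

IsHd : CSet → ℕ → Set
IsHd F k = (F ≡ [] × k ≡ 0)
         ⊎ ((F ≢ []) × Σ PAss (λ φ → HdUnsat (φ * F) k)
                     × (∀ φ k' → HdUnsat (φ * F) k' → k' ≤ k))

-- Positions: current θ and m = number of
-- Prover moves so far (= variables assigned by Prover in any play that
-- ends with ⊥, since each such Prover move assigns exactly one variable).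

Ended : CSet → PAss → Set
Ended F θ = HasBot (θ * F) ⊎ IsTop (θ * F)

ProverMove : CSet → PAss → PAss → Set
ProverMove F θ θ' = (θ ⊏ θ') × (IsTop (θ' * F) ⊎ OneMore θ θ')

mutual
  data DelayerGuarD (F : CSet) (k : ℕ) : PAss → ℕ → Set where
    endBot : ∀ {θ m} → HasBot (θ * F) → k ≤ m → DelayerGuarD F k θ m
    endTop : ∀ {θ m} → IsTop (θ * F) → k ≤ 0 → DelayerGuarD F k θ m
    move   : ∀ {θ m} → (Ended F θ → Data.Empty.⊥) →
             (θ' : PAss) → θ ⊑ θ' → VarsIn θ' F →
             DelayerGuarP F k θ' m → DelayerGuarD F k θ m

  data DelayerGuarP (F : CSet) (k : ℕ) : PAss → ℕ → Set where
    endBot : ∀ {θ m} → HasBot (θ * F) → k ≤ m → DelayerGuarP F k θ m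
    endTop : ∀ {θ m} → IsTop (θ * F) → k ≤ 0 → DelayerGuarP F k θ m
    move   : ∀ {θ m} → (Ended F θ → Data.Empty.⊥) →
             (∀ θ' → ProverMove F θ θ' → VarsIn θ' F → DelayerGuarD F k θ' (suc m)) →
             DelayerGuarP F k θ m

mutual
  data ProverLimD (F : CSet) (k : ℕ) : PAss → ℕ → Set where
    endBot : ∀ {θ m} → HasBot (θ * F) → m ≤ k → ProverLimD F k θ m
    endTop : ∀ {θ m} → IsTop (θ * F) → ProverLimD F k θ m
    move   : ∀ {θ m} → (Ended F θ → Data.Empty.⊥) →
             (∀ θ' → θ ⊑ θ' → VarsIn θ' F → ProverLimP F k θ' m) →
             ProverLimD F k θ m

  data ProverLimP (F : CSet) (k : ℕ) : PAss → ℕ → Set where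
    endBot : ∀ {θ m} → HasBot (θ * F) → m ≤ k → ProverLimP F k θ m
    endTop : ∀ {θ m} → IsTop (θ * F) → ProverLimP F k θ m
    move   : ∀ {θ m} → (Ended F θ → Data.Empty.⊥) →
             (θ' : PAss) → ProverMove F θ θ' → VarsIn θ' F →
             ProverLimD F k θ' (suc m) → ProverLimP F k θ m

-- Hardness has a splitting characterisation: hd(θ * F) ≤ i + 1 iff some variable x of F and value ε
-- give hd(θ[x≔ε] * F) ≤ i and hd(θ[x≔¬ε] * F) ≤ i + 1.  Both directions transform resolution trees
-- without increasing their Horton–Strahler number: refutations of the two branches are lifted to
-- derivations of the unit clauses on x and resolved, and conversely the two premises of the final
-- resolution step are restricted by the two values of its pivot.
--
-- Prover, facing the assignment θ chosen by Delayer, either completes θ to a satisfying assignment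
-- or follows a splitting of θ * F of least level, always choosing the branch of lower level; each of
-- his moves then lowers the level by one, so Delayer scores at most hd(F).  Delayer first jumps to
-- the assignment φ with hd(φ * F) = hd(F) and, before each Prover move, fixes every variable one of
-- whose values would leave too little hardness to the opposite value.  This keeps m + hd(θ * F) ≥
-- hd(F) after m Prover moves, so when ⊥ appears Delayer has scored at least hd(F).

module Submission where

open import Defs
open import Data.Nat using (ℕ; zero; suc; _≤_; _<_; _+_; _∸_; _⊔_; _≡ᵇ_; z≤n; s≤s; _≤?_)
open import Data.Nat.Properties
open import Data.List.Properties using () renaming (≡-dec to ≡-dec-List)
open import Data.Bool using (Bool; true; false; not; _∨_; T?)
open import Data.Bool.Properties using (not-involutive; ¬-not; not-¬; T-≡; T-not-≡) renaming (_≟_ to _≟ᵇ_)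
open import Data.Product using (Σ; ∃; _×_; _,_; proj₁; proj₂)
open import Data.Product.Properties using (≡-dec)
open import Data.Sum using (_⊎_; inj₁; inj₂; [_,_]′; map₁)
open import Data.Maybe using (Maybe; just; nothing; is-nothing; _<∣>_)
open import Data.List using (List; []; _∷_; filter; filterᵇ; _++_; length; map; concatMap)
open import Data.Bool.ListAction using (any)
open import Data.List.Membership.Propositional using (_∈_; _∉_; find; lose)
open import Data.List.Membership.Propositional.Properties
  using (∈-++⁺ˡ; ∈-++⁺ʳ; ∈-++⁻; ∈-filter⁺; ∈-filter⁻)
open import Data.List.Relation.Unary.Any using (here; there)
open import Data.List.Relation.Unary.Any.Properties using (¬Any[]; any⁺; any⁻; map⁺; map⁻; concatMap⁺; concatMap⁻)
import Data.List.Relation.Unary.Any as Any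
open import Data.Empty using (⊥; ⊥-elim)
open import Function using (_∘_; Equivalence)
open import Relation.Nullary using (¬_; Dec; yes; no; ¬?; _×-dec_)
open import Relation.Binary.PropositionalEquality hiding ([_])
open import Relation.Binary.Definitions using (tri<; tri≈; tri>)

open Equivalence using (to; from)

module _ {A : Set} (p : A → Bool) where

  any-true⁻ : ∀ xs → any p xs ≡ true → ∃ λ x → x ∈ xs × p x ≡ true
  any-true⁻ xs e with x , x∈ , px ← find (any⁻ p xs (from T-≡ e)) = x , x∈ , to T-≡ px

  any-true⁺ : ∀ {xs x} → x ∈ xs → p x ≡ true → any p xs ≡ true
  any-true⁺ x∈ px = to T-≡ (any⁺ p (lose x∈ (from T-≡ px)))

  any-false⁻ : ∀ {xs x} → any p xs ≡ false → x ∈ xs → p x ≡ false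
  any-false⁻ {x = x} e x∈ with p x in px
  ... | true  with () ← trans (sym (any-true⁺ x∈ px)) e
  ... | false = refl

  any-false⁺ : ∀ xs → (∀ {x} → x ∈ xs → p x ≡ false) → any p xs ≡ false
  any-false⁺ xs h with any p xs in e
  ... | false = refl
  ... | true  with x , x∈ , px ← any-true⁻ xs e with () ← trans (sym px) (h x∈)

⊆-singleton : ∀ {A : Set} (a : A) {xs} → (∀ {x} → x ∈ xs → x ≡ a) → xs ≡ [] ⊎ a ∈ xs
⊆-singleton a {[]}    _   = inj₁ refl
⊆-singleton a {x ∷ _} ⊆a = inj₂ (here (sym (⊆a (here refl))))

∉⇒≡[] : ∀ {A : Set} (xs : List A) → (∀ {x} → x ∉ xs) → xs ≡ []
∉⇒≡[] []      _ = refl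
∉⇒≡[] (x ∷ _) ∉ = ⊥-elim (∉ (here refl))

∃∈? : ∀ {A : Set} (xs : List A) (P : A → Set) → (∀ {x} → x ∈ xs → Dec (P x)) → Dec (∃ λ x → x ∈ xs × P x)
∃∈? []       P P? = no λ ()
∃∈? (y ∷ xs) P P? with P? (here refl) | ∃∈? xs P (P? ∘ there)
... | yes py | _                  = yes (y , here refl , py)
... | no _   | yes (x , x∈ , px)  = yes (x , there x∈ , px)
... | no ¬py | no ¬rest           =
  no λ { (x , here refl , px) → ¬py px ; (x , there x∈ , px) → ¬rest (x , x∈ , px) }

module _ {A : Set} (p q : A → Bool) (p⇒q : ∀ x → p x ≡ true → q x ≡ true) where

  count-mono : ∀ xs → length (filterᵇ p xs) ≤ length (filterᵇ q xs)
  count-mono []       = z≤n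
  count-mono (x ∷ xs) with p x in px | q x in qx
  ... | true  | true  = s≤s (count-mono xs)
  ... | true  | false with () ← trans (sym qx) (p⇒q x px)
  ... | false | true  = m≤n⇒m≤1+n (count-mono xs)
  ... | false | false = count-mono xs

  count-mono-< : ∀ {xs x} → x ∈ xs → p x ≡ false → q x ≡ true →
                 length (filterᵇ p xs) < length (filterᵇ q xs)
  count-mono-< {x ∷ xs} (here refl) px qx rewrite px | qx = s≤s (count-mono xs)
  count-mono-< {y ∷ xs} (there x∈) px qx with p y in py | q y in qy
  ... | true  | true  = s≤s (count-mono-< x∈ px qx)
  ... | true  | false with () ← trans (sym qy) (p⇒q y py)
  ... | false | true  = m≤n⇒m≤1+n (count-mono-< x∈ px qx)
  ... | false | false = count-mono-< x∈ px qx

update : (Var → Maybe Bool) → Var → Bool → Var → Maybe Bool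
update f x b v with v ≟ x
... | yes _ = just b
... | no  _ = f v

infixl 30 _[_≔_]

_[_≔_] : PAss → Var → Bool → PAss
θ [ x ≔ b ] = record { val = update (val θ) x b ; bound = bound θ ⊔ suc x ; fin = beyond }
  where
  beyond : ∀ v → bound θ ⊔ suc x ≤ v → update (val θ) x b v ≡ nothing
  beyond v le with v ≟ x
  ... | yes refl = ⊥-elim (<-irrefl refl (m⊔n≤o⇒n≤o (bound θ) (suc x) le))
  ... | no  _    = fin θ v (m⊔n≤o⇒m≤o (bound θ) (suc x) le)

[≔]-updates : ∀ θ x b → val (θ [ x ≔ b ]) x ≡ just b
[≔]-updates θ x b with x ≟ x
... | yes _  = refl
... | no x≢x = ⊥-elim (x≢x refl)

[≔]-minimal : ∀ θ {x} b {v} → v ≢ x → val (θ [ x ≔ b ]) v ≡ val θ v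
[≔]-minimal θ {x} b {v} v≢x with v ≟ x
... | yes v≡x = ⊥-elim (v≢x v≡x)
... | no  _   = refl

[≔]-assigned : ∀ θ x b → val (θ [ x ≔ b ]) x ≢ nothing
[≔]-assigned θ x b e with () ← trans (sym ([≔]-updates θ x b)) e

⊑-refl : ∀ θ → θ ⊑ θ
⊑-refl θ v b e = e

⊑-trans : ∀ θ ψ χ → θ ⊑ ψ → ψ ⊑ χ → θ ⊑ χ
⊑-trans θ ψ χ θ⊑ψ ψ⊑χ v b = ψ⊑χ v b ∘ θ⊑ψ v b

assigned⇒just : ∀ {θ v} → val θ v ≢ nothing → ∃ λ b → val θ v ≡ just b
assigned⇒just {θ} {v} assigned with val θ v
... | just b  = b , refl
... | nothing = ⊥-elim (assigned refl)

⊑-assigned : ∀ {θ ψ x} → θ ⊑ ψ → val θ x ≢ nothing → val ψ x ≢ nothing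
⊑-assigned {θ} {x = x} θ⊑ψ θx e with val θ x in θx′
... | nothing = θx refl
... | just b with () ← trans (sym (θ⊑ψ x b θx′)) e

⊑-[≔] : ∀ θ x b → val θ x ≡ nothing → θ ⊑ θ [ x ≔ b ]
⊑-[≔] θ x b θx≡nothing v c e with v ≟ x
... | yes refl with () ← trans (sym θx≡nothing) e
... | no  _ = e

[≔]-mono : ∀ θ ψ x b → θ ⊑ ψ → θ [ x ≔ b ] ⊑ ψ [ x ≔ b ]
[≔]-mono θ ψ x b θ⊑ψ v c e with v ≟ x
... | yes _ = e
... | no  _ = θ⊑ψ v c e

[≔]-⊑ : ∀ θ ψ x b → θ ⊑ ψ → val ψ x ≡ just b → θ [ x ≔ b ] ⊑ ψ
[≔]-⊑ θ ψ x b θ⊑ψ ψx≡b v c e with v ≟ x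
... | yes refl = trans ψx≡b e
... | no  _    = θ⊑ψ v c e

only-v-changed⇒⊑[≔] : ∀ θ θ′ v b → (∀ w → w ≢ v → val θ′ w ≡ val θ w) → val θ′ v ≡ just b → θ′ ⊑ θ [ v ≔ b ]
only-v-changed⇒⊑[≔] θ θ′ v b others θ′v w c e with w ≟ v
... | yes refl = trans (sym θ′v) e
... | no  w≢v  = trans (sym (others w w≢v)) e

merge : PAss → PAss → PAss
merge θ χ = record { val = λ v → val θ v <∣> val χ v ; bound = bound θ ⊔ bound χ ; fin = beyond }
  where
  beyond : ∀ v → bound θ ⊔ bound χ ≤ v → (val θ v <∣> val χ v) ≡ nothing
  beyond v le rewrite fin θ v (m⊔n≤o⇒m≤o (bound θ) (bound χ) le) = fin χ v (m⊔n≤o⇒n≤o (bound θ) (bound χ) le)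

⊑-merge : ∀ θ χ → θ ⊑ merge θ χ
⊑-merge θ χ v b e rewrite e = refl

_≟ˡ_ : (l l′ : Lit) → Dec (l ≡ l′)
_≟ˡ_ = ≡-dec _≟_ _≟ᵇ_

open import Data.List.Membership.DecPropositional _≟ˡ_ using (_∈?_)
open import Data.List.Membership.DecPropositional _≟_ using () renaming (_∈?_ to _∈ⁿ?_)
open import Data.List.Membership.DecPropositional (≡-dec-List _≟ˡ_) using () renaming (_∈?_ to _∈ᶜ?_)

neg-involutive : ∀ l → neg (neg l) ≡ l
neg-involutive (v , b) = cong (v ,_) (not-involutive b)

neg-≢ : ∀ l → neg l ≢ l
neg-≢ (v , true)  ()
neg-≢ (v , false) ()

eqB-not : ∀ c b → eqB c (not b) ≡ not (eqB c b)
eqB-not true  true  = refl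
eqB-not true  false = refl
eqB-not false true  = refl
eqB-not false false = refl

¬eqB⇒≡not : ∀ c b → not (eqB c b) ≡ true → b ≡ not c
¬eqB⇒≡not true  false _ = refl
¬eqB⇒≡not false true  _ = refl

litTrue⇒¬litFalse : ∀ φ l → litTrue φ l ≡ true → litFalse φ l ≡ false
litTrue⇒¬litFalse φ (v , b) e with val φ v
... | just c rewrite e = refl

litFalse⇒¬litTrue : ∀ φ l → litFalse φ l ≡ true → litTrue φ l ≡ false
litFalse⇒¬litTrue φ l e with litTrue φ l in t
... | true  = trans (sym e) (litTrue⇒¬litFalse φ l t)
... | false = refl

neither⇒unassigned : ∀ φ l → litTrue φ l ≡ false → litFalse φ l ≡ false → val φ (proj₁ l) ≡ nothing
neither⇒unassigned φ (v , b) t f with val φ v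
... | nothing = refl
... | just c with eqB c b
neither⇒unassigned φ (v , b) () f | just c | true
neither⇒unassigned φ (v , b) t () | just c | false

litTrue-neg : ∀ φ l → litTrue φ (neg l) ≡ litFalse φ l
litTrue-neg φ (v , b) with val φ v
... | just c  = eqB-not c b
... | nothing = refl

litFalse-neg : ∀ φ l → litFalse φ (neg l) ≡ litTrue φ l
litFalse-neg φ (v , b) with val φ v
... | just c  rewrite eqB-not c b = not-involutive (eqB c b)
... | nothing = refl

litTrue-cong : ∀ φ ψ l → val φ (proj₁ l) ≡ val ψ (proj₁ l) → litTrue φ l ≡ litTrue ψ l
litTrue-cong φ ψ (v , b) e rewrite e = refl

litFalse-cong : ∀ φ ψ l → val φ (proj₁ l) ≡ val ψ (proj₁ l) → litFalse φ l ≡ litFalse ψ l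
litFalse-cong φ ψ (v , b) e rewrite e = refl

litTrue-mono : ∀ θ ψ → θ ⊑ ψ → ∀ l → litTrue θ l ≡ true → litTrue ψ l ≡ true
litTrue-mono θ ψ θ⊑ψ (v , b) e with val θ v in eq
... | just c rewrite θ⊑ψ v c eq = e

litFalse-mono : ∀ θ ψ → θ ⊑ ψ → ∀ l → litFalse θ l ≡ true → litFalse ψ l ≡ true
litFalse-mono θ ψ θ⊑ψ (v , b) e with val θ v in eq
... | just c rewrite θ⊑ψ v c eq = e

¬litTrue-anti : ∀ θ ψ → θ ⊑ ψ → ∀ l → litTrue ψ l ≡ false → litTrue θ l ≡ false
¬litTrue-anti θ ψ θ⊑ψ l e with litTrue θ l in t
... | true  = trans (sym (litTrue-mono θ ψ θ⊑ψ l t)) e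
... | false = refl

¬litFalse-anti : ∀ θ ψ → θ ⊑ ψ → ∀ l → litFalse ψ l ≡ false → litFalse θ l ≡ false
¬litFalse-anti θ ψ θ⊑ψ l e with litFalse θ l in f
... | true  = trans (sym (litFalse-mono θ ψ θ⊑ψ l f)) e
... | false = refl

litFalse-[≔] : ∀ θ x {b c} → b ≢ c → litFalse (θ [ x ≔ b ]) (x , c) ≡ true
litFalse-[≔] θ x {b} {c} b≢c rewrite [≔]-updates θ x b with b | c
... | true  | true  = ⊥-elim (b≢c refl)
... | true  | false = refl
... | false | true  = refl
... | false | false = ⊥-elim (b≢c refl)

newly-false : ∀ θ x b l → litFalse (θ [ x ≔ b ]) l ≡ true → litFalse θ l ≡ false → l ≡ (x , not b)
newly-false θ x b (v , c) f f′ with v ≟ x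
... | no  _ with () ← trans (sym f) f′
... | yes refl = cong (v ,_) (¬eqB⇒≡not b c f)

satisfies : PAss → Clause → Bool
satisfies φ C = any (litTrue φ) C

reduce : PAss → Clause → Clause
reduce φ C = filterᵇ (λ l → not (litFalse φ l)) C

∈-*⁻ : ∀ φ F {D} → D ∈ φ * F → ∃ λ C → C ∈ F × satisfies φ C ≡ false × D ≡ reduce φ C
∈-*⁻ φ (C ∷ F) D∈ with satisfies φ C in s
... | true with C′ , C′∈ , s′ , refl ← ∈-*⁻ φ F D∈ = C′ , there C′∈ , s′ , refl
∈-*⁻ φ (C ∷ F) (here refl) | false = C , here refl , s , refl
∈-*⁻ φ (C ∷ F) (there D∈) | false with C′ , C′∈ , s′ , refl ← ∈-*⁻ φ F D∈ = C′ , there C′∈ , s′ , refl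

∈-*⁺ : ∀ φ F {C} → C ∈ F → satisfies φ C ≡ false → reduce φ C ∈ φ * F
∈-*⁺ φ (C ∷ F) (here refl) s rewrite s = here refl
∈-*⁺ φ (C′ ∷ F) (there C∈) s with satisfies φ C′
... | true  = ∈-*⁺ φ F C∈ s
... | false = there (∈-*⁺ φ F C∈ s)

*≡[]⇒satisfies : ∀ φ F → φ * F ≡ [] → ∀ {C} → C ∈ F → satisfies φ C ≡ true
*≡[]⇒satisfies φ (C ∷ F) e C′∈ with satisfies φ C in s
*≡[]⇒satisfies φ (C ∷ F) e (here refl) | true = s
*≡[]⇒satisfies φ (C ∷ F) e (there C′∈) | true = *≡[]⇒satisfies φ F e C′∈

satisfies⇒*≡[] : ∀ φ F → (∀ {C} → C ∈ F → satisfies φ C ≡ true) → φ * F ≡ []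
satisfies⇒*≡[] φ []      h = refl
satisfies⇒*≡[] φ (C ∷ F) h rewrite h (here refl) = satisfies⇒*≡[] φ F (h ∘ there)

∈-reduce⁺ : ∀ φ {C l} → l ∈ C → litFalse φ l ≡ false → l ∈ reduce φ C
∈-reduce⁺ φ l∈ f = ∈-filter⁺ (T? ∘ _) l∈ (from T-not-≡ f)

∈-reduce⁻ : ∀ φ {C l} → l ∈ reduce φ C → l ∈ C × litFalse φ l ≡ false
∈-reduce⁻ φ l∈ with l∈C , f ← ∈-filter⁻ (T? ∘ _) l∈ = l∈C , to T-not-≡ f

reduce-unassigned : ∀ φ {C l} → satisfies φ C ≡ false → l ∈ reduce φ C → val φ (proj₁ l) ≡ nothing
reduce-unassigned φ {C} {l} s l∈ with l∈C , f ← ∈-reduce⁻ φ {C} l∈ =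
  neither⇒unassigned φ l (any-false⁻ (litTrue φ) s l∈C) f

reduce≡[]⁻ : ∀ φ {C} → reduce φ C ≡ [] → ∀ {l} → l ∈ C → litFalse φ l ≡ true
reduce≡[]⁻ φ e {l} l∈ with litFalse φ l in f
... | true  = refl
... | false with () ← subst (l ∈_) e (∈-reduce⁺ φ l∈ f)

reduce≡[]⁺ : ∀ φ C → (∀ {l} → l ∈ C → litFalse φ l ≡ true) → reduce φ C ≡ []
reduce≡[]⁺ φ []      h = refl
reduce≡[]⁺ φ (l ∷ C) h rewrite h (here refl) = reduce≡[]⁺ φ C (h ∘ there)

satisfies-mono : ∀ θ ψ → θ ⊑ ψ → ∀ C → satisfies θ C ≡ true → satisfies ψ C ≡ true
satisfies-mono θ ψ θ⊑ψ C s with l , l∈ , t ← any-true⁻ _ C s = any-true⁺ _ l∈ (litTrue-mono θ ψ θ⊑ψ l t)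

*≡[]-mono : ∀ θ ψ F → θ ⊑ ψ → θ * F ≡ [] → ψ * F ≡ []
*≡[]-mono θ ψ F θ⊑ψ e = satisfies⇒*≡[] ψ F (λ {C} → satisfies-mono θ ψ θ⊑ψ C ∘ *≡[]⇒satisfies θ F e)

⊥∈*-mono : ∀ θ ψ F → θ ⊑ ψ → HasBot (θ * F) → HasBot (ψ * F)
⊥∈*-mono θ ψ F θ⊑ψ ⊥∈ with C , C∈ , _ , e ← ∈-*⁻ θ F ⊥∈ =
  subst (_∈ ψ * F) (reduce≡[]⁺ ψ C falseψ)
        (∈-*⁺ ψ F C∈ (any-false⁺ _ C (λ l∈ → litFalse⇒¬litTrue ψ _ (falseψ l∈))))
  where
  falseψ : ∀ {l} → l ∈ C → litFalse ψ l ≡ true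
  falseψ l∈ = litFalse-mono θ ψ θ⊑ψ _ (reduce≡[]⁻ θ (sym e) l∈)

*-isClauseSet : ∀ φ F → IsClauseSet F → IsClauseSet (φ * F)
*-isClauseSet φ F cs D D∈ l l∈ ¬l∈ with C , C∈ , _ , refl ← ∈-*⁻ φ F D∈ =
  cs C C∈ l (proj₁ (∈-reduce⁻ φ l∈)) (proj₁ (∈-reduce⁻ φ ¬l∈))

module _ (φ ψ : PAss) where

  AgreeOn : Clause → Set
  AgreeOn C = ∀ {l} → l ∈ C → val φ (proj₁ l) ≡ val ψ (proj₁ l)

  satisfies-cong : ∀ C → AgreeOn C → satisfies φ C ≡ satisfies ψ C
  satisfies-cong []      h = refl
  satisfies-cong (l ∷ C) h = cong₂ _∨_ (litTrue-cong φ ψ l (h (here refl))) (satisfies-cong C (h ∘ there))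

  reduce-cong : ∀ C → AgreeOn C → reduce φ C ≡ reduce ψ C
  reduce-cong []      h = refl
  reduce-cong (l ∷ C) h with litFalse φ l | litFalse ψ l | litFalse-cong φ ψ l (h (here refl))
  ... | true  | .true  | refl = reduce-cong C (h ∘ there)
  ... | false | .false | refl = cong (l ∷_) (reduce-cong C (h ∘ there))

  *-cong : ∀ F → (∀ {C} → C ∈ F → AgreeOn C) → φ * F ≡ ψ * F
  *-cong []      h = refl
  *-cong (C ∷ F) h
    rewrite satisfies-cong C (h (here refl)) | reduce-cong C (h (here refl)) | *-cong F (h ∘ there) = refl

*-reduced-≡[] : ∀ θ ψ F → θ ⊑ ψ → ψ * F ≡ [] → ψ * (θ * F) ≡ []
*-reduced-≡[] θ ψ F θ⊑ψ e = satisfies⇒*≡[] ψ (θ * F) ψ-satisfies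
  where
  ψ-satisfies : ∀ {D} → D ∈ θ * F → satisfies ψ D ≡ true
  ψ-satisfies D∈ with C , C∈ , _ , refl ← ∈-*⁻ θ F D∈
                 with l , l∈ , t ← any-true⁻ _ C (*≡[]⇒satisfies ψ F e C∈) =
    any-true⁺ (litTrue ψ) (∈-reduce⁺ θ {C} l∈ (¬litFalse-anti θ ψ θ⊑ψ l (litTrue⇒¬litFalse ψ l t))) t

merge-*≡[] : ∀ θ χ F → χ * (θ * F) ≡ [] → merge θ χ * F ≡ []
merge-*≡[] θ χ F e = satisfies⇒*≡[] (merge θ χ) F merge-satisfies
  where
  merge-satisfies : ∀ {C} → C ∈ F → satisfies (merge θ χ) C ≡ true
  merge-satisfies {C} C∈ with satisfies θ C in s
  ... | true  = satisfies-mono θ (merge θ χ) (⊑-merge θ χ) C s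
  ... | false with l , l∈ , t ← any-true⁻ _ (reduce θ C) (*≡[]⇒satisfies χ (θ * F) e (∈-*⁺ θ F C∈ s)) =
    any-true⁺ (litTrue (merge θ χ)) (proj₁ (∈-reduce⁻ θ {C} l∈)) (trans (litTrue-cong (merge θ χ) χ l χ-decides) t)
    where
    χ-decides : val (merge θ χ) (proj₁ l) ≡ val χ (proj₁ l)
    χ-decides rewrite reduce-unassigned θ {C} s l∈ = refl

*-[≔]-shrinks : ∀ θ F x b → val θ x ≡ nothing → ∀ {D} → D ∈ θ [ x ≔ b ] * F →
                ∃ λ E → E ∈ θ * F × (∀ {l} → l ∈ E → l ∈ D ⊎ l ≡ (x , not b))
*-[≔]-shrinks θ F x b θx D∈ with C , C∈ , s , refl ← ∈-*⁻ (θ [ x ≔ b ]) F D∈ =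
  reduce θ C , ∈-*⁺ θ F C∈ θ-unsatisfied , shrinks
  where
  ψ = θ [ x ≔ b ]
  θ-unsatisfied : satisfies θ C ≡ false
  θ-unsatisfied = any-false⁺ _ C (λ l∈ → ¬litTrue-anti θ ψ (⊑-[≔] θ x b θx) _ (any-false⁻ (litTrue ψ) s l∈))
  shrinks : ∀ {l} → l ∈ reduce θ C → l ∈ reduce ψ C ⊎ l ≡ (x , not b)
  shrinks {l} l∈ with l∈C , nf ← ∈-reduce⁻ θ {C} l∈ with litFalse ψ l in f
  ... | true  = inj₂ (newly-false θ x b l f nf)
  ... | false = inj₁ (∈-reduce⁺ ψ l∈C f)

*-[≔]-avoids : ∀ θ F x b → ∀ {D} → D ∈ θ [ x ≔ b ] * F → ∀ {l} → l ∈ D → proj₁ l ≢ x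
*-[≔]-avoids θ F x b D∈ {l} l∈ refl with C , C∈ , s , refl ← ∈-*⁻ (θ [ x ≔ b ]) F D∈ =
  [≔]-assigned θ x b (reduce-unassigned (θ [ x ≔ b ]) {C} s l∈)

*-⊑-restricts : ∀ θ ψ F → θ ⊑ ψ → ∀ {D} → D ∈ θ * F → (∀ {l} → l ∈ D → litTrue ψ l ≡ false) →
                ∃ λ E → E ∈ ψ * F × (∀ {l} → l ∈ E → l ∈ D × litFalse ψ l ≡ false)
*-⊑-restricts θ ψ F θ⊑ψ D∈ ¬true with C , C∈ , s , refl ← ∈-*⁻ θ F D∈ =
  reduce ψ C , ∈-*⁺ ψ F C∈ (any-false⁺ _ C ψ-unsatisfied) , restricts
  where
  ψ-unsatisfied : ∀ {l} → l ∈ C → litTrue ψ l ≡ false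
  ψ-unsatisfied {l} l∈ with litTrue ψ l in t
  ... | false = refl
  ... | true with litFalse θ l in f
  ...   | true  = trans (sym (litFalse-mono θ ψ θ⊑ψ l f)) (litTrue⇒¬litFalse ψ l t)
  ...   | false = trans (sym t) (¬true (∈-reduce⁺ θ l∈ f))
  restricts : ∀ {l} → l ∈ reduce ψ C → l ∈ reduce θ C × litFalse ψ l ≡ false
  restricts {l} l∈ with l∈C , nf ← ∈-reduce⁻ ψ {C} l∈ = ∈-reduce⁺ θ l∈C (¬litFalse-anti θ ψ θ⊑ψ l nf) , nf

HasBot? : ∀ G → Dec (HasBot G)
HasBot? G = [] ∈ᶜ? G

IsTop? : ∀ G → Dec (IsTop G)
IsTop? []      = yes refl
IsTop? (_ ∷ _) = no λ ()

unsat⇒≢[] : ∀ {G} → Unsat G → G ≢ []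
unsat⇒≢[] unsat refl = unsat emptyPA refl

-- Horton–Strahler numbers

≡ᵇ-refl : ∀ a → (a ≡ᵇ a) ≡ true
≡ᵇ-refl a = to T-≡ (≡⇒≡ᵇ a a refl)

≢⇒≡ᵇ-false : ∀ {a b} → a ≢ b → (a ≡ᵇ b) ≡ false
≢⇒≡ᵇ-false {a} {b} a≢b with a ≡ᵇ b in e
... | true  = ⊥-elim (a≢b (≡ᵇ⇒≡ a b (from T-≡ e)))
... | false = refl

htsNode-diag : ∀ a → htsNode a a ≡ suc a
htsNode-diag a rewrite ≡ᵇ-refl a = refl

htsNode-< : ∀ {a b} → a < b → htsNode a b ≡ b
htsNode-< a<b rewrite ≢⇒≡ᵇ-false (<⇒≢ a<b) = m≤n⇒m⊔n≡n (<⇒≤ a<b)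

htsNode-> : ∀ {a b} → b < a → htsNode a b ≡ a
htsNode-> b<a rewrite ≢⇒≡ᵇ-false (≢-sym (<⇒≢ b<a)) = m≥n⇒m⊔n≡m (<⇒≤ b<a)

⊔≤htsNode : ∀ a b → a ⊔ b ≤ htsNode a b
⊔≤htsNode a b with a ≡ᵇ b in e
... | false = ≤-refl
... | true rewrite ≡ᵇ⇒≡ a b (from T-≡ e) | ⊔-idem b = n≤1+n b

htsNode-≤ˡ : ∀ a b → a ≤ htsNode a b
htsNode-≤ˡ a b = ≤-trans (m≤m⊔n a b) (⊔≤htsNode a b)

htsNode-≤ʳ : ∀ a b → b ≤ htsNode a b
htsNode-≤ʳ a b = ≤-trans (m≤n⊔m a b) (⊔≤htsNode a b)

htsNode-mono : ∀ {a′ b′ a b} → a′ ≤ a → b′ ≤ b → htsNode a′ b′ ≤ htsNode a b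
htsNode-mono {a′} {b′} {a} {b} a′≤a b′≤b with a′ ≡ᵇ b′ in e
... | false = ≤-trans (⊔-mono-≤ a′≤a b′≤b) (⊔≤htsNode a b)
... | true with refl ← ≡ᵇ⇒≡ a′ b′ (from T-≡ e) with <-cmp a b
... | tri≈ _ refl _ rewrite htsNode-diag a = s≤s a′≤a
... | tri< a<b _ _ rewrite htsNode-< a<b = ≤-trans (s≤s a′≤a) a<b
... | tri> _ _ b<a rewrite htsNode-> b<a = ≤-trans (s≤s b′≤b) b<a

htsNode-≤-suc : ∀ {a b i} → a ≤ i → b ≤ suc i → htsNode a b ≤ suc i
htsNode-≤-suc {a} {b} a≤i b≤1+i with a ≡ᵇ b
... | true  = s≤s a≤i
... | false = ⊔-lub (m≤n⇒m≤1+n a≤i) b≤1+i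

-- Resolution trees

Resolves : Lit → Clause → Clause → Clause → Set
Resolves y C₁ C₂ R = ∀ l → (l ∈ R → (l ∈ C₁ ⊎ l ∈ C₂) × l ≢ y × l ≢ neg y)
                         × ((l ∈ C₁ ⊎ l ∈ C₂) × l ≢ y × l ≢ neg y → l ∈ R)

resolvent : Lit → Clause → Clause → Clause
resolvent y C₁ C₂ = filter (λ l → ¬? (l ≟ˡ y) ×-dec ¬? (l ≟ˡ neg y)) (C₁ ++ C₂)

resolvent-resolves : ∀ y C₁ C₂ → Resolves y C₁ C₂ (resolvent y C₁ C₂)
resolvent-resolves y C₁ C₂ l =
    (λ l∈ → let l∈C₁₂ , l≢y , l≢ȳ = ∈-filter⁻ P? {xs = C₁ ++ C₂} l∈ in ∈-++⁻ C₁ l∈C₁₂ , l≢y , l≢ȳ)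
  , (λ (l∈C₁₂ , l≢y , l≢ȳ) → ∈-filter⁺ P? {xs = C₁ ++ C₂} ([ ∈-++⁺ˡ , ∈-++⁺ʳ C₁ ]′ l∈C₁₂) (l≢y , l≢ȳ))
  where
  P? = λ l → ¬? (l ≟ˡ y) ×-dec ¬? (l ≟ˡ neg y)

neg∈⇒∉ : ∀ {C y} → IsClause C → neg y ∈ C → y ∉ C
neg∈⇒∉ {C} {y} cl ȳ∈ y∈ = cl (neg y) ȳ∈ (subst (_∈ C) (sym (neg-involutive y)) y∈)

label-lits : ∀ (Q : Lit → Set) G → (∀ {D} → D ∈ G → ∀ {l} → l ∈ D → Q l) →
             ∀ T → ValidTree G T → ∀ {l} → l ∈ label T → Q l
label-lits Q G h (leaf C) v {l} l∈ with D , D∈ , C≈D ← find v = h D∈ (proj₁ (C≈D l) l∈)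
label-lits Q G h (node R T₁ T₂) ((y , _ , _ , _ , res) , V₁ , V₂) {l} l∈ with proj₁ (proj₁ (res l) l∈)
... | inj₁ l∈₁ = label-lits Q G h T₁ V₁ l∈₁
... | inj₂ l∈₂ = label-lits Q G h T₂ V₂ l∈₂

label-isClause : ∀ G → IsClauseSet G → ∀ T → ValidTree G T → IsClause (label T)
label-isClause G cs (leaf C) v l l∈ l̄∈ with D , D∈ , C≈D ← find v =
  cs D D∈ l (proj₁ (C≈D l) l∈) (proj₁ (C≈D (neg l)) l̄∈)
label-isClause G cs (node R T₁ T₂) ((y , _ , _ , unique , res) , V₁ , V₂) l l∈ l̄∈
  with proj₁ (res l) l∈ | proj₁ (res (neg l)) l̄∈
... | inj₁ l∈₁ , _ | inj₁ l̄∈₁ , _ = label-isClause G cs T₁ V₁ l l∈₁ l̄∈₁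
... | inj₂ l∈₂ , _ | inj₂ l̄∈₂ , _ = label-isClause G cs T₂ V₂ l l∈₂ l̄∈₂
... | inj₁ l∈₁ , l≢y , _ | inj₂ l̄∈₂ , _ = l≢y (unique l l∈₁ l̄∈₂)
... | inj₂ l∈₂ , _ , l≢ȳ | inj₁ l̄∈₁ , _ =
  l≢ȳ (trans (sym (neg-involutive l))
             (cong neg (unique (neg l) l̄∈₁ (subst (_∈ label T₂) (sym (neg-involutive l)) l∈₂))))

module _ {y C₁ C₂ R} (res : Resolves y C₁ C₂ R) where

  resolves-⊇₁ : ∀ {l} → IsClause C₁ → y ∈ C₁ → l ∈ C₁ → l ≢ y → l ∈ R
  resolves-⊇₁ cl₁ y∈C₁ l∈ l≢y = proj₂ (res _) (inj₁ l∈ , l≢y , λ { refl → cl₁ y y∈C₁ l∈ })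

  resolves-⊇₂ : ∀ {l} → IsClause C₂ → neg y ∈ C₂ → l ∈ C₂ → l ≢ neg y → l ∈ R
  resolves-⊇₂ cl₂ ȳ∈C₂ l∈ l≢ȳ = proj₂ (res _) (inj₂ l∈ , (λ { refl → neg∈⇒∉ cl₂ ȳ∈C₂ l∈ }) , l≢ȳ)

  resolves-⊥⁻₁ : ∀ {l} → R ≡ [] → IsClause C₁ → y ∈ C₁ → l ∈ C₁ → l ≡ y
  resolves-⊥⁻₁ {l} refl cl₁ y∈C₁ l∈ with l ≟ˡ y
  ... | yes l≡y = l≡y
  ... | no  l≢y with () ← resolves-⊇₁ cl₁ y∈C₁ l∈ l≢y

  resolves-⊥⁻₂ : ∀ {l} → R ≡ [] → IsClause C₂ → neg y ∈ C₂ → l ∈ C₂ → l ≡ neg y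
  resolves-⊥⁻₂ {l} refl cl₂ ȳ∈C₂ l∈ with l ≟ˡ neg y
  ... | yes l≡ȳ = l≡ȳ
  ... | no  l≢ȳ with () ← resolves-⊇₂ cl₂ ȳ∈C₂ l∈ l≢ȳ

resolves-⊥ : ∀ {y C₁ C₂} → (∀ {l} → l ∈ C₁ → l ≡ y) → (∀ {l} → l ∈ C₂ → l ≡ neg y) → Resolves y C₁ C₂ []
resolves-⊥ ⊆y ⊆ȳ l = (λ ()) , λ { (inj₁ l∈ , l≢y , _) → ⊥-elim (l≢y (⊆y l∈))
                                 ; (inj₂ l∈ , _ , l≢ȳ) → ⊥-elim (l≢ȳ (⊆ȳ l∈)) }

-- If the premises of a resolution step are replaced by derivations of subclauses (up to Extra
-- literals), either one of them already misses the pivot or the step can be redone.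
module Reresolve {G : CSet} (Extra : Lit → Set) {C₁ C₂ R : Clause} {y : Lit}
  (y∈C₁ : y ∈ C₁) (ȳ∈C₂ : neg y ∈ C₂) (res : Resolves y C₁ C₂ R)
  (cl₁ : IsClause C₁) (cl₂ : IsClause C₂)
  {T₁ T₂ : RTree} (V₁ : ValidTree G T₁) (V₂ : ValidTree G T₂)
  (sub₁ : ∀ {l} → l ∈ label T₁ → l ∈ C₁ ⊎ Extra l)
  (sub₂ : ∀ {l} → l ∈ label T₂ → l ∈ C₂ ⊎ Extra l)
  (unique : ∀ z → z ∈ label T₁ → neg z ∈ label T₂ → z ≡ y) where

  in-R₁ : ∀ {l} → l ∈ C₁ → l ≢ y → l ∈ R
  in-R₁ = resolves-⊇₁ res cl₁ y∈C₁

  in-R₂ : ∀ {l} → l ∈ C₂ → l ≢ neg y → l ∈ R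
  in-R₂ = resolves-⊇₂ res cl₂ ȳ∈C₂

  reresolve : Σ RTree λ T → ValidTree G T
              × (∀ {l} → l ∈ label T → (l ∈ R ⊎ Extra l) × (l ∈ label T₁ ⊎ l ∈ label T₂))
              × hts T ≤ htsNode (hts T₁) (hts T₂)
  reresolve with y ∈? label T₁ | neg y ∈? label T₂
  ... | no y∉ | _ =
    T₁ , V₁ , (λ l∈ → map₁ (λ l∈C₁ → in-R₁ l∈C₁ λ { refl → y∉ l∈ }) (sub₁ l∈) , inj₁ l∈) ,
    htsNode-≤ˡ (hts T₁) (hts T₂)
  ... | yes _ | no ȳ∉ =
    T₂ , V₂ , (λ l∈ → map₁ (λ l∈C₂ → in-R₂ l∈C₂ λ { refl → ȳ∉ l∈ }) (sub₂ l∈) , inj₂ l∈) ,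
    htsNode-≤ʳ (hts T₁) (hts T₂)
  ... | yes y∈ | yes ȳ∈ =
    node (resolvent y (label T₁) (label T₂)) T₁ T₂ ,
    ((y , y∈ , ȳ∈ , unique , resolvent-resolves y _ _) , V₁ , V₂) , in-R , ≤-refl
    where
    in-R : ∀ {l} → l ∈ resolvent y (label T₁) (label T₂) → (l ∈ R ⊎ Extra l) × (l ∈ label T₁ ⊎ l ∈ label T₂)
    in-R {l} l∈ with proj₁ (resolvent-resolves y (label T₁) (label T₂) l) l∈
    ... | inj₁ l∈₁ , l≢y , _ = map₁ (λ l∈C₁ → in-R₁ l∈C₁ l≢y) (sub₁ l∈₁) , inj₁ l∈₁
    ... | inj₂ l∈₂ , _ , l≢ȳ = map₁ (λ l∈C₂ → in-R₂ l∈C₂ l≢ȳ) (sub₂ l∈₂) , inj₂ l∈₂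

≈C-refl : ∀ C → C ≈C C
≈C-refl C l = (λ l∈ → l∈) , (λ l∈ → l∈)

module Lift {G G′ : CSet} (l₀ : Lit) (cs′ : IsClauseSet G′)
  (shrinks : ∀ {D} → D ∈ G′ → ∃ λ E → E ∈ G × (∀ {l} → l ∈ E → l ∈ D ⊎ l ≡ l₀))
  (avoids : ∀ {D} → D ∈ G′ → ∀ {l} → l ∈ D → proj₁ l ≢ proj₁ l₀) where

  lift : ∀ T → ValidTree G′ T →
         Σ RTree λ T′ → ValidTree G T′ × (∀ {l} → l ∈ label T′ → l ∈ label T ⊎ l ≡ l₀) × hts T′ ≤ hts T
  lift (leaf C) v with D , D∈ , C≈D ← find v with E , E∈ , E⊆D+l₀ ← shrinks D∈ =
    leaf E , lose E∈ (≈C-refl E) , (λ {l} l∈ → map₁ (proj₂ (C≈D l)) (E⊆D+l₀ l∈)) , z≤n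
  lift (node R T₁ T₂) ((y , y∈ , ȳ∈ , unique , res) , V₁ , V₂) with lift T₁ V₁ | lift T₂ V₂
  ... | T₁′ , V₁′ , sub₁ , h₁ | T₂′ , V₂′ , sub₂ , h₂ =
    let T′ , V′ , sub′ , h′ = Reresolve.reresolve (_≡ l₀) y∈ ȳ∈ res (label-isClause G′ cs′ T₁ V₁)
                                (label-isClause G′ cs′ T₂ V₂) V₁′ V₂′ sub₁ sub₂ unique′
    in T′ , V′ , proj₁ ∘ sub′ , ≤-trans h′ (htsNode-mono h₁ h₂)
    where
    avoids-label : ∀ T → ValidTree G′ T → ∀ {l} → l ∈ label T → proj₁ l ≢ proj₁ l₀
    avoids-label = label-lits (λ l → proj₁ l ≢ proj₁ l₀) G′ avoids

    unique′ : ∀ z → z ∈ label T₁′ → neg z ∈ label T₂′ → z ≡ y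
    unique′ z z∈ z̄∈ with sub₁ z∈ | sub₂ z̄∈
    ... | inj₁ z∈₁ | inj₁ z̄∈₂ = unique z z∈₁ z̄∈₂
    ... | inj₁ z∈₁ | inj₂ z̄≡l₀ = ⊥-elim (avoids-label T₁ V₁ z∈₁ (cong proj₁ z̄≡l₀))
    ... | inj₂ z≡l₀ | inj₁ z̄∈₂ = ⊥-elim (avoids-label T₂ V₂ z̄∈₂ (cong proj₁ z≡l₀))
    ... | inj₂ z≡l₀ | inj₂ z̄≡l₀ = ⊥-elim (neg-≢ z (trans z̄≡l₀ (sym z≡l₀)))

module Restrict {G G′ : CSet} (ψ : PAss) (cs : IsClauseSet G)
  (restricts : ∀ {D} → D ∈ G → (∀ {l} → l ∈ D → litTrue ψ l ≡ false) →
               ∃ λ E → E ∈ G′ × (∀ {l} → l ∈ E → l ∈ D × litFalse ψ l ≡ false)) where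

  Restriction : RTree → Set
  Restriction T = Σ RTree λ T′ → ValidTree G′ T′
                  × (∀ {l} → l ∈ label T′ → l ∈ label T × litFalse ψ l ≡ false) × hts T′ ≤ hts T

  restrict : ∀ T → ValidTree G T → (∀ {l} → l ∈ label T → litTrue ψ l ≡ false) → Restriction T
  restrict (leaf C) v ¬true with D , D∈ , C≈D ← find v
                            with E , E∈ , E⊆ ← restricts D∈ (λ {l} l∈ → ¬true (proj₂ (C≈D l) l∈)) =
    leaf E , lose E∈ (≈C-refl E) , (λ {l} l∈ → proj₂ (C≈D l) (proj₁ (E⊆ l∈)) , proj₂ (E⊆ l∈)) , z≤n
  restrict (node R T₁ T₂) ((y , y∈ , ȳ∈ , unique , res) , V₁ , V₂) ¬true = by-value-of-y
    where
    cl₁ : IsClause (label T₁)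
    cl₁ = label-isClause G cs T₁ V₁
    cl₂ : IsClause (label T₂)
    cl₂ = label-isClause G cs T₂ V₂
    in-R₁ : ∀ {l} → l ∈ label T₁ → l ≢ y → l ∈ R
    in-R₁ = resolves-⊇₁ res cl₁ y∈
    in-R₂ : ∀ {l} → l ∈ label T₂ → l ≢ neg y → l ∈ R
    in-R₂ = resolves-⊇₂ res cl₂ ȳ∈

    ¬true₁ : litTrue ψ y ≡ false → ∀ {l} → l ∈ label T₁ → litTrue ψ l ≡ false
    ¬true₁ y-not-true {l} l∈ with l ≟ˡ y
    ... | yes refl = y-not-true
    ... | no  l≢y  = ¬true (in-R₁ l∈ l≢y)

    ¬true₂ : litTrue ψ (neg y) ≡ false → ∀ {l} → l ∈ label T₂ → litTrue ψ l ≡ false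
    ¬true₂ ȳ-not-true {l} l∈ with l ≟ˡ neg y
    ... | yes refl = ȳ-not-true
    ... | no  l≢ȳ  = ¬true (in-R₂ l∈ l≢ȳ)

    ȳ-not-true : litTrue ψ y ≡ true → litTrue ψ (neg y) ≡ false
    ȳ-not-true y-true = trans (litTrue-neg ψ y) (litTrue⇒¬litFalse ψ y y-true)

    by-value-of-y : Restriction (node R T₁ T₂)
    by-value-of-y with litTrue ψ y in y-true | litFalse ψ y in y-false
    ... | true | _ with T₂′ , V₂′ , sub₂ , h₂ ← restrict T₂ V₂ (¬true₂ (ȳ-not-true y-true)) =
      T₂′ , V₂′ , (λ l∈ → let l∈₂ , nf = sub₂ l∈ in in-R₂ l∈₂ (λ { refl → ȳ-not-false nf }) , nf) ,
      ≤-trans h₂ (htsNode-≤ʳ (hts T₁) (hts T₂))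
      where
      ȳ-not-false : litFalse ψ (neg y) ≢ false
      ȳ-not-false e with () ← trans (sym (trans (litFalse-neg ψ y) y-true)) e
    ... | false | true with T₁′ , V₁′ , sub₁ , h₁ ← restrict T₁ V₁ (¬true₁ y-true) =
      T₁′ , V₁′ , (λ l∈ → let l∈₁ , nf = sub₁ l∈ in in-R₁ l∈₁ (λ { refl → y-not-false nf }) , nf) ,
      ≤-trans h₁ (htsNode-≤ˡ (hts T₁) (hts T₂))
      where
      y-not-false : litFalse ψ y ≢ false
      y-not-false e with () ← trans (sym y-false) e
    ... | false | false with restrict T₁ V₁ (¬true₁ y-true)
                           | restrict T₂ V₂ (¬true₂ (trans (litTrue-neg ψ y) y-false))
    ... | T₁′ , V₁′ , sub₁ , h₁ | T₂′ , V₂′ , sub₂ , h₂ =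
      let T′ , V′ , sub′ , h′ = Reresolve.reresolve (λ _ → ⊥) y∈ ȳ∈ res cl₁ cl₂ V₁′ V₂′
                                  (inj₁ ∘ proj₁ ∘ sub₁) (inj₁ ∘ proj₁ ∘ sub₂)
                                  (λ z z∈ z̄∈ → unique z (proj₁ (sub₁ z∈)) (proj₁ (sub₂ z̄∈)))
      in T′ , V′ , in-R-not-false {T′} sub′ , ≤-trans h′ (htsNode-mono h₁ h₂)
      where
      in-R-not-false : ∀ {T′} → (∀ {l} → l ∈ label T′ → (l ∈ R ⊎ ⊥) × (l ∈ label T₁′ ⊎ l ∈ label T₂′)) →
                       ∀ {l} → l ∈ label T′ → l ∈ R × litFalse ψ l ≡ false
      in-R-not-false sub′ l∈ with sub′ l∈
      ... | inj₁ l∈R , inj₁ l∈₁ = l∈R , proj₂ (sub₁ l∈₁)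
      ... | inj₁ l∈R , inj₂ l∈₂ = l∈R , proj₂ (sub₂ l∈₂)

vars : CSet → List Var
vars = concatMap (map proj₁)

∈vars⁺ : ∀ {v} F → v ∈var F → v ∈ vars F
∈vars⁺ F v∈ = concatMap⁺ (map proj₁) (Any.map (map⁺ ∘ Any.map sym) v∈)

∈vars⁻ : ∀ {v} F → v ∈ vars F → v ∈var F
∈vars⁻ F v∈ = Any.map (Any.map sym ∘ map⁻) (concatMap⁻ (map proj₁) {xs = F} v∈)

lit∈vars : ∀ F {C l} → C ∈ F → l ∈ C → proj₁ l ∈ vars F
lit∈vars F C∈ l∈ = ∈vars⁺ F (lose C∈ (lose l∈ refl))

-- Splitting refutations

module _ (F : CSet) where

  unassigned : PAss → ℕ
  unassigned θ = length (filterᵇ (is-nothing ∘ val θ) (vars F))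

  is-nothing-anti : ∀ θ ψ → θ ⊑ ψ → ∀ v → is-nothing (val ψ v) ≡ true → is-nothing (val θ v) ≡ true
  is-nothing-anti θ ψ θ⊑ψ v e with val θ v in θv
  ... | nothing = refl
  ... | just c rewrite θ⊑ψ v c θv = e

  unassigned-< : ∀ θ ψ {x} → θ ⊑ ψ → x ∈ vars F → val θ x ≡ nothing → val ψ x ≢ nothing →
                 unassigned ψ < unassigned θ
  unassigned-< θ ψ {x} θ⊑ψ x∈ θx ψx = count-mono-< _ _ (is-nothing-anti θ ψ θ⊑ψ) x∈ ψx-assigned θx-free
    where
    ψx-assigned : is-nothing (val ψ x) ≡ false
    ψx-assigned with val ψ x
    ... | nothing = ⊥-elim (ψx refl)
    ... | just _  = refl
    θx-free : is-nothing (val θ x) ≡ true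
    θx-free rewrite θx = refl

  unassigned-[≔] : ∀ θ {x} b → x ∈ vars F → val θ x ≡ nothing → unassigned (θ [ x ≔ b ]) < unassigned θ
  unassigned-[≔] θ {x} b x∈ θx = unassigned-< θ (θ [ x ≔ b ]) (⊑-[≔] θ x b θx) x∈ θx ([≔]-assigned θ x b)

  out-of-fuel : ∀ θ {x} → x ∈ vars F → val θ x ≡ nothing → ¬ unassigned θ ≤ 0
  out-of-fuel θ x∈ θx le with () ← ≤-trans (unassigned-[≔] θ true x∈ θx) le

  fuel-[≔] : ∀ θ {x n} b → x ∈ vars F → val θ x ≡ nothing → unassigned θ ≤ suc n →
             unassigned (θ [ x ≔ b ]) ≤ n
  fuel-[≔] θ b x∈ θx le = ≤-pred (≤-trans (unassigned-[≔] θ b x∈ θx) le)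

  VarsIn-[≔] : ∀ θ {x} b → VarsIn θ F → x ∈ vars F → VarsIn (θ [ x ≔ b ]) F
  VarsIn-[≔] θ {x} b θ⊆F x∈ v assigned with v ≟ x
  ... | yes refl = ∈vars⁻ F x∈
  ... | no  _    = θ⊆F v assigned

  -- SplitRef i θ is the recursive characterisation of hd(θ * F) ≤ i.
  data SplitRef : ℕ → PAss → Set where
    falsified : ∀ {i θ} → HasBot (θ * F) → SplitRef i θ
    split     : ∀ {i θ} x ε → x ∈ vars F → val θ x ≡ nothing →
                SplitRef i (θ [ x ≔ ε ]) → SplitRef (suc i) (θ [ x ≔ not ε ]) → SplitRef (suc i) θ

  SplitRef-weaken : ∀ {i j θ} → i ≤ j → SplitRef i θ → SplitRef j θ
  SplitRef-weaken _ (falsified ⊥∈) = falsified ⊥∈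
  SplitRef-weaken (s≤s i≤j) (split x ε x∈ θx r r′) =
    split x ε x∈ θx (SplitRef-weaken i≤j r) (SplitRef-weaken (s≤s i≤j) r′)

  SplitRef-mono : ∀ {i θ ψ} → θ ⊑ ψ → SplitRef i θ → SplitRef i ψ
  SplitRef-mono {θ = θ} {ψ} θ⊑ψ (falsified ⊥∈) = falsified (⊥∈*-mono θ ψ F θ⊑ψ ⊥∈)
  SplitRef-mono {suc i} {θ} {ψ} θ⊑ψ (split x ε x∈ θx r r′) with val ψ x in ψx
  ... | nothing = split x ε x∈ ψx (SplitRef-mono ([≔]-mono θ ψ x ε θ⊑ψ) r)
                                  (SplitRef-mono ([≔]-mono θ ψ x (not ε) θ⊑ψ) r′)
  ... | just c with c ≟ᵇ ε
  ... | yes refl = SplitRef-weaken (n≤1+n i) (SplitRef-mono ([≔]-⊑ θ ψ x c θ⊑ψ ψx) r)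
  ... | no  c≢ε  = SplitRef-mono ([≔]-⊑ θ ψ x (not ε) θ⊑ψ (trans ψx (cong just (¬-not c≢ε)))) r′

  SplitRef⇒¬top : ∀ {i θ} → SplitRef i θ → θ * F ≢ []
  SplitRef⇒¬top (falsified ⊥∈) e with () ← subst HasBot e ⊥∈
  SplitRef⇒¬top {θ = θ} (split x ε x∈ θx r r′) e =
    SplitRef⇒¬top r′ (*≡[]-mono θ (θ [ x ≔ not ε ]) F (⊑-[≔] θ x (not ε) θx) e)

  *-lits-free : ∀ θ {D} → D ∈ θ * F → ∀ {l} → l ∈ D → val θ (proj₁ l) ≡ nothing × proj₁ l ∈ vars F
  *-lits-free θ D∈ l∈ with C , C∈ , s , refl ← ∈-*⁻ θ F D∈ =
    reduce-unassigned θ {C} s l∈ , lit∈vars F C∈ (proj₁ (∈-reduce⁻ θ {C} l∈))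

  SplitRef⇒unsat : ∀ {j θ} → SplitRef j θ → Unsat (θ * F)
  SplitRef⇒unsat {θ = θ} r χ e = SplitRef⇒¬top (SplitRef-mono (⊑-merge θ χ) r) (merge-*≡[] θ χ F e)

  SplitRef-node : ∀ θ {x} b {i j} → x ∈ vars F → val θ x ≡ nothing →
                  SplitRef i (θ [ x ≔ not b ]) → SplitRef j (θ [ x ≔ b ]) → SplitRef (htsNode i j) θ
  SplitRef-node θ {x} b {i} {j} x∈ θx r₀ r₁ with <-cmp i j
  ... | tri≈ _ refl _ rewrite htsNode-diag i = split x b x∈ θx r₁ (SplitRef-weaken (n≤1+n i) r₀)
  ... | tri< i<j _ _ rewrite htsNode-< i<j with suc j′ ← j =
    split x (not b) x∈ θx (SplitRef-weaken (≤-pred i<j) r₀)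
          (subst (λ c → SplitRef (suc j′) (θ [ x ≔ c ])) (sym (not-involutive b)) r₁)
  ... | tri> _ _ j<i rewrite htsNode-> j<i with suc i′ ← i = split x b x∈ θx (SplitRef-weaken (≤-pred j<i) r₁) r₀

  lift-[≔] : IsClauseSet F → ∀ θ x b → val θ x ≡ nothing → ∀ {T} → Refutation (θ [ x ≔ b ] * F) T →
             Σ RTree λ T′ → ValidTree (θ * F) T′ × (∀ {l} → l ∈ label T′ → l ≡ (x , not b)) × hts T′ ≤ hts T
  lift-[≔] cs θ x b θx {T} (V , ⊥-root)
    with T′ , V′ , sub , h ← Lift.lift (x , not b) (*-isClauseSet (θ [ x ≔ b ]) F cs)
                               (*-[≔]-shrinks θ F x b θx) (*-[≔]-avoids θ F x b) T V =
    T′ , V′ , from-unit ∘ sub , h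
    where
    from-unit : ∀ {l} → l ∈ label T ⊎ l ≡ (x , not b) → l ≡ (x , not b)
    from-unit {l} (inj₁ l∈) with () ← subst (l ∈_) ⊥-root l∈
    from-unit (inj₂ e) = e

  -- The lifted refutations of the two branches derive ⊥ or the complementary unit clauses on x.
  SplitRef⇒refutation : IsClauseSet F → ∀ {j θ} → SplitRef j θ → Σ RTree λ T → Refutation (θ * F) T × hts T ≤ j
  SplitRef⇒refutation cs (falsified ⊥∈) = leaf [] , (lose ⊥∈ (≈C-refl []) , refl) , z≤n
  SplitRef⇒refutation cs {suc i} {θ} (split x ε x∈ θx r₀ r₁)
    with T₀ , R₀ , h₀ ← SplitRef⇒refutation cs r₀ | T₁ , R₁ , h₁ ← SplitRef⇒refutation cs r₁
    with T₀′ , V₀′ , sub₀ , k₀ ← lift-[≔] cs θ x ε θx R₀ | T₁′ , V₁′ , sub₁ , k₁ ← lift-[≔] cs θ x (not ε) θx R₁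
    with ⊆-singleton (x , not ε) sub₀ | ⊆-singleton (x , not (not ε)) sub₁
  ... | inj₁ ⊥₀ | _ = T₀′ , (V₀′ , ⊥₀) , ≤-trans k₀ (≤-trans h₀ (n≤1+n i))
  ... | inj₂ _ | inj₁ ⊥₁ = T₁′ , (V₁′ , ⊥₁) , ≤-trans k₁ h₁
  ... | inj₂ l₀∈ | inj₂ l̄₀∈ =
    node [] T₀′ T₁′ ,
    ((((x , not ε) , l₀∈ , l̄₀∈ , (λ _ z∈ _ → sub₀ z∈) , resolves-⊥ sub₀ sub₁) , V₀′ , V₁′) , refl) ,
    htsNode-≤-suc (≤-trans k₀ h₀) (≤-trans k₁ h₁)

  refutation-⊑ : IsClauseSet F → ∀ θ ψ → θ ⊑ ψ → ∀ {l₀} → litFalse ψ l₀ ≡ true →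
                 ∀ T → ValidTree (θ * F) T → (∀ {l} → l ∈ label T → l ≡ l₀) →
                 Σ RTree λ T′ → Refutation (ψ * F) T′ × hts T′ ≤ hts T
  refutation-⊑ cs θ ψ θ⊑ψ {l₀} l₀-false T V ⊆l₀ =
    let T′ , V′ , sub , h = Restrict.restrict ψ (*-isClauseSet θ F cs) (*-⊑-restricts θ ψ F θ⊑ψ) T V ¬true
    in T′ , (V′ , ∉⇒≡[] (label T′) (∉ sub)) , h
    where
    ¬true : ∀ {l} → l ∈ label T → litTrue ψ l ≡ false
    ¬true l∈ rewrite ⊆l₀ l∈ = litFalse⇒¬litTrue ψ l₀ l₀-false
    ∉ : ∀ {C} → (∀ {l} → l ∈ C → l ∈ label T × litFalse ψ l ≡ false) → ∀ {l} → l ∉ C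
    ∉ sub l∈ with l∈T , nf ← sub l∈ rewrite ⊆l₀ l∈T with () ← trans (sym l₀-false) nf

  -- Split on the pivot of the last resolution step; its premises, restricted to either value,
  -- refute the branches.
  refutation⇒SplitRef : IsClauseSet F → ∀ n θ → unassigned θ ≤ n →
                        ∀ T → Refutation (θ * F) T → SplitRef (hts T) θ
  refutation⇒SplitRef cs n θ fuel (leaf C) (v , refl) with D , D∈ , []≈D ← find v =
    falsified (subst (_∈ θ * F) (∉⇒≡[] D (λ l∈ → ¬Any[] (proj₂ ([]≈D _) l∈))) D∈)
  refutation⇒SplitRef cs n θ fuel (node R T₁ T₂) ((((x , b) , y∈ , ȳ∈ , _ , res) , V₁ , V₂) , R≡[])
    with label-lits (λ l → val θ (proj₁ l) ≡ nothing × proj₁ l ∈ vars F) (θ * F) (*-lits-free θ) T₁ V₁ y∈ | n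
  ... | θx , x∈ | zero = ⊥-elim (out-of-fuel θ x∈ θx fuel)
  ... | θx , x∈ | suc n′ =
    let T₁′ , R₁′ , h₁ = refutation-⊑ cs θ (θ [ x ≔ not b ]) (⊑-[≔] θ x (not b) θx)
                           (litFalse-[≔] θ x (≢-sym (not-¬ refl))) T₁ V₁
                           (resolves-⊥⁻₁ res R≡[] (label-isClause (θ * F) cs′ T₁ V₁) y∈)
        T₂′ , R₂′ , h₂ = refutation-⊑ cs θ (θ [ x ≔ b ]) (⊑-[≔] θ x b θx)
                           (litFalse-[≔] θ x (not-¬ refl)) T₂ V₂
                           (resolves-⊥⁻₂ res R≡[] (label-isClause (θ * F) cs′ T₂ V₂) ȳ∈)
    in SplitRef-node θ b x∈ θx
         (SplitRef-weaken h₁ (refutation⇒SplitRef cs n′ _ (fuel-[≔] θ (not b) x∈ θx fuel) T₁′ R₁′))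
         (SplitRef-weaken h₂ (refutation⇒SplitRef cs n′ _ (fuel-[≔] θ b x∈ θx fuel) T₂′ R₂′))
    where
    cs′ : IsClauseSet (θ * F)
    cs′ = *-isClauseSet θ F cs

  SplitRef? : ∀ n i θ → unassigned θ ≤ n → Dec (SplitRef i θ)
  SplitRef? n i θ fuel with HasBot? (θ * F)
  ... | yes ⊥∈ = yes (falsified ⊥∈)
  SplitRef? n       zero    θ fuel | no ⊥∉ = no λ { (falsified ⊥∈) → ⊥∉ ⊥∈ }
  SplitRef? zero    (suc i) θ fuel | no ⊥∉ =
    no λ { (falsified ⊥∈) → ⊥∉ ⊥∈ ; (split x ε x∈ θx _ _) → out-of-fuel θ x∈ θx fuel }
  SplitRef? (suc n) (suc i) θ fuel | no ⊥∉ with ∃∈? (vars F) Splits splits?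
    where
    Splits : Var → Set
    Splits x = val θ x ≡ nothing × ∃ λ ε → SplitRef i (θ [ x ≔ ε ]) × SplitRef (suc i) (θ [ x ≔ not ε ])
    splits-by? : ∀ {x} → x ∈ vars F → val θ x ≡ nothing → ∀ ε →
                 Dec (SplitRef i (θ [ x ≔ ε ]) × SplitRef (suc i) (θ [ x ≔ not ε ]))
    splits-by? x∈ θx ε = SplitRef? n i _ (fuel-[≔] θ ε x∈ θx fuel)
                   ×-dec SplitRef? n (suc i) _ (fuel-[≔] θ (not ε) x∈ θx fuel)
    splits? : ∀ {x} → x ∈ vars F → Dec (Splits x)
    splits? {x} x∈ with val θ x in θx
    ... | just _  = no λ ()
    ... | nothing with splits-by? x∈ θx true | splits-by? x∈ θx false
    ...   | yes s | _     = yes (refl , true , s)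
    ...   | no _  | yes s = yes (refl , false , s)
    ...   | no ¬t | no ¬f = no λ { (refl , true , s) → ¬t s ; (refl , false , s) → ¬f s }
  ... | yes (x , x∈ , θx , ε , r , r′) = yes (split x ε x∈ θx r r′)
  ... | no ¬split = no λ { (falsified ⊥∈) → ⊥∉ ⊥∈ ; (split x ε x∈ θx r r′) → ¬split (x , x∈ , θx , ε , r , r′) }

  least-SplitRef : ∀ j θ → SplitRef j θ → ∃ λ j₀ → SplitRef j₀ θ × (∀ i → SplitRef i θ → j₀ ≤ i)
  least-SplitRef zero    θ r = 0 , r , λ _ _ → z≤n
  least-SplitRef (suc j) θ r with SplitRef? (unassigned θ) j θ ≤-refl
  ... | yes r′ = least-SplitRef j θ r′
  ... | no ¬r′ = suc j , r , least
    where
    least : ∀ i → SplitRef i θ → suc j ≤ i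
    least i rᵢ with suc j ≤? i
    ... | yes j<i = j<i
    ... | no  j≮i = ⊥-elim (¬r′ (SplitRef-weaken (≤-pred (≰⇒> j≮i)) rᵢ))

  SplitRef⇒hd : IsClauseSet F → ∀ {j θ} → SplitRef j θ → ∃ λ j₀ → SplitRef j₀ θ × HdUnsat (θ * F) j₀
  SplitRef⇒hd cs {j} {θ} r with j₀ , r₀ , least ← least-SplitRef j θ r
                           with T , R , h ← SplitRef⇒refutation cs r₀ =
    j₀ , r₀ , SplitRef⇒unsat r₀ , (T , R , ≤-antisym h (lower-bound T R)) , lower-bound
    where
    lower-bound : ∀ T → Refutation (θ * F) T → j₀ ≤ hts T
    lower-bound T R = least _ (refutation⇒SplitRef cs _ θ ≤-refl T R)

  HdUnsat-≤-SplitRef : IsClauseSet F → ∀ {θ k i} → HdUnsat (θ * F) k → SplitRef i θ → k ≤ i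
  HdUnsat-≤-SplitRef cs (_ , _ , minimal) r with T , R , h ← SplitRef⇒refutation cs r = ≤-trans (minimal T R) h

  Refutable : PAss → Set
  Refutable θ = ∃ λ j → SplitRef j θ

  SatisfyingExtension : PAss → Set
  SatisfyingExtension θ = ∃ λ ψ → θ ⊏ ψ × IsTop (ψ * F) × VarsIn ψ F

  satisfying-[≔] : ∀ θ {x} b → x ∈ vars F → val θ x ≡ nothing → VarsIn θ F →
                   IsTop (θ [ x ≔ b ] * F) ⊎ SatisfyingExtension (θ [ x ≔ b ]) → SatisfyingExtension θ
  satisfying-[≔] θ {x} b x∈ θx θ⊆F (inj₁ top) =
    θ [ x ≔ b ] , (⊑-[≔] θ x b θx , x , θx , [≔]-assigned θ x b) , top , VarsIn-[≔] θ b θ⊆F x∈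
  satisfying-[≔] θ {x} b x∈ θx θ⊆F (inj₂ (ψ , (θ′⊑ψ , _) , top , ψ⊆F)) =
    ψ , (⊑-trans θ (θ [ x ≔ b ]) ψ (⊑-[≔] θ x b θx) θ′⊑ψ ,
         x , θx , ⊑-assigned {θ [ x ≔ b ]} {ψ} {x} θ′⊑ψ ([≔]-assigned θ x b)) ,
    top , ψ⊆F

  top⊎satisfiable⊎refutable : ∀ n θ → unassigned θ ≤ n → VarsIn θ F →
                              IsTop (θ * F) ⊎ SatisfyingExtension θ ⊎ Refutable θ
  top⊎satisfiable⊎refutable n θ fuel θ⊆F with θ * F in eq
  ... | []      = inj₁ refl
  ... | [] ∷ _  = inj₂ (inj₂ (0 , falsified (subst HasBot (sym eq) (here refl))))
  ... | (l ∷ D) ∷ _ with n | fuel | *-lits-free θ (subst ((l ∷ D) ∈_) (sym eq) (here refl)) (here {x = l} refl)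
  ...   | zero | fuel′ | θx , x∈ = ⊥-elim (out-of-fuel θ x∈ θx fuel′)
  ...   | suc n′ | fuel′ | θx , x∈
    with top⊎satisfiable⊎refutable n′ _ (fuel-[≔] θ true x∈ θx fuel′) (VarsIn-[≔] θ true θ⊆F x∈)
       | top⊎satisfiable⊎refutable n′ _ (fuel-[≔] θ false x∈ θx fuel′) (VarsIn-[≔] θ false θ⊆F x∈)
  ... | inj₁ top        | _ = inj₂ (inj₁ (satisfying-[≔] θ true x∈ θx θ⊆F (inj₁ top)))
  ... | inj₂ (inj₁ ext) | _ = inj₂ (inj₁ (satisfying-[≔] θ true x∈ θx θ⊆F (inj₂ ext)))
  ... | inj₂ (inj₂ _)   | inj₁ top        = inj₂ (inj₁ (satisfying-[≔] θ false x∈ θx θ⊆F (inj₁ top)))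
  ... | inj₂ (inj₂ _)   | inj₂ (inj₁ ext) = inj₂ (inj₁ (satisfying-[≔] θ false x∈ θx θ⊆F (inj₂ ext)))
  ... | inj₂ (inj₂ (j₀ , r₀)) | inj₂ (inj₂ (j₁ , r₁)) =
    inj₂ (inj₂ (suc (j₀ ⊔ j₁) , split (proj₁ l) true x∈ θx (SplitRef-weaken (m≤m⊔n j₀ j₁) r₀)
                                      (SplitRef-weaken (m≤n⇒m≤1+n (m≤n⊔m j₀ j₁)) r₁)))

  keepVars : (Var → Maybe Bool) → Var → Maybe Bool
  keepVars f v with v ∈ⁿ? vars F
  ... | yes _ = f v
  ... | no  _ = nothing

  restrictVars : PAss → PAss
  restrictVars φ = record { val = keepVars (val φ) ; bound = bound φ ; fin = beyond }
    where
    beyond : ∀ v → bound φ ≤ v → keepVars (val φ) v ≡ nothing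
    beyond v le with v ∈ⁿ? vars F
    ... | yes _ = fin φ v le
    ... | no  _ = refl

  restrictVars-VarsIn : ∀ φ → VarsIn (restrictVars φ) F
  restrictVars-VarsIn φ v assigned with v ∈ⁿ? vars F
  ... | yes v∈ = ∈vars⁻ F v∈
  ... | no  _  = ⊥-elim (assigned refl)

  restrictVars-* : ∀ φ → φ * F ≡ restrictVars φ * F
  restrictVars-* φ = *-cong φ (restrictVars φ) F agree
    where
    agree : ∀ {C} → C ∈ F → AgreeOn φ (restrictVars φ) C
    agree C∈ {l} l∈ with proj₁ l ∈ⁿ? vars F
    ... | yes _   = refl
    ... | no  l∉ = ⊥-elim (l∉ (lit∈vars F C∈ l∈))

  -- The Prover–Delayer game

  data Status (θ : PAss) : Set where
    ⊥-reached : HasBot (θ * F) → Status θ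
    ⊤-reached : IsTop (θ * F) → Status θ
    running   : ¬ Ended F θ → Status θ

  status : ∀ θ → Status θ
  status θ with HasBot? (θ * F) | IsTop? (θ * F)
  ... | yes ⊥∈ | _      = ⊥-reached ⊥∈
  ... | no _   | yes ⊤∈ = ⊤-reached ⊤∈
  ... | no ⊥∉  | no ⊤∉  = running [ ⊥∉ , ⊤∉ ]′

  [≔]-ProverMove : ∀ θ x ε → val θ x ≡ nothing → ProverMove F θ (θ [ x ≔ ε ])
  [≔]-ProverMove θ x ε θx =
    (θ⊑ , x , θx , [≔]-assigned θ x ε) , inj₂ (θ⊑ , x , θx , [≔]-assigned θ x ε , λ _ → [≔]-minimal θ ε)
    where θ⊑ = ⊑-[≔] θ x ε θx

  IsHd-maximal : ∀ {k θ j} → IsHd F k → HdUnsat (θ * F) j → j ≤ k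
  IsHd-maximal {θ = θ} (inj₁ (F≡[] , _)) (unsat , _) = ⊥-elim (unsat⇒≢[] unsat (cong (θ *_) F≡[]))
  IsHd-maximal {θ = θ} (inj₂ (_ , _ , maximal)) hd = maximal θ _ hd

  module Strategies (cs : IsClauseSet F) (k : ℕ) where

    -- m + hd(θ * F) ≥ k, stated through splitting refutations.
    Promising : PAss → ℕ → Set
    Promising θ m = ∀ i → SplitRef i θ → k ≤ m + i

    reached-⊥ : ∀ {θ m} → Promising θ m → HasBot (θ * F) → k ≤ m
    reached-⊥ {m = m} promising ⊥∈ = subst (k ≤_) (+-identityʳ m) (promising 0 (falsified ⊥∈))

    record Good (θ : PAss) (m : ℕ) : Set where
      field
        within    : VarsIn θ F
        promising : Promising θ m
        refutable : Refutable θ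

    Stable : PAss → ℕ → Set
    Stable θ m = ∀ {x} → x ∈ vars F → val θ x ≡ nothing → ∀ ε → Promising (θ [ x ≔ ε ]) (suc m)

    -- A Prover move x ≔ ε breaks the invariant iff θ[x≔ε] splits at a level i with suc m + i < k;
    -- slack m is the largest such i.
    slack : ℕ → ℕ
    slack m = k ∸ suc (suc m)

    Dangerous : PAss → ℕ → Var → Set
    Dangerous θ m x = val θ x ≡ nothing × suc (suc m) ≤ k × ∃ λ ε → SplitRef (slack m) (θ [ x ≔ ε ])

    Dangerous? : ∀ θ m x → Dec (Dangerous θ m x)
    Dangerous? θ m x with val θ x | suc (suc m) ≤? k
    ... | just _  | _       = no λ ()
    ... | nothing | no  m≰k = no λ (_ , m≤k , _) → m≰k m≤k
    ... | nothing | yes m≤k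
      with SplitRef? (unassigned (θ [ x ≔ true ])) (slack m) (θ [ x ≔ true ]) ≤-refl
         | SplitRef? (unassigned (θ [ x ≔ false ])) (slack m) (θ [ x ≔ false ]) ≤-refl
    ...   | yes r | _     = yes (refl , m≤k , true , r)
    ...   | no _  | yes r = yes (refl , m≤k , false , r)
    ...   | no ¬t | no ¬f = no λ { (_ , _ , true , r) → ¬t r ; (_ , _ , false , r) → ¬f r }

    above-slack : ∀ {m} → suc (suc m) ≤ k → ¬ k ≤ m + suc (slack m)
    above-slack {m} 2+m≤k k≤ =
      1+n≰n (subst (suc (suc (m + slack m)) ≤_) (+-suc m (slack m))
                   (subst (_≤ m + suc (slack m)) (sym (m+[n∸m]≡n 2+m≤k)) k≤))

    below-slack : ∀ {m i} → ¬ k ≤ suc m + i → suc (suc m) ≤ k × i ≤ slack m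
    below-slack {m} {i} k≰ =
      m+n≤o⇒m≤o (suc (suc m)) 2+m+i≤k , m+n≤o⇒m≤o∸n i (subst (_≤ k) (+-comm (suc (suc m)) i) 2+m+i≤k)
      where
      2+m+i≤k : suc (suc m) + i ≤ k
      2+m+i≤k = ≰⇒> k≰

    dodge : ∀ θ m {x ε} → x ∈ vars F → val θ x ≡ nothing → suc (suc m) ≤ k →
            SplitRef (slack m) (θ [ x ≔ ε ]) → Promising θ m → Promising (θ [ x ≔ not ε ]) m
    dodge θ m {x} {ε} x∈ θx 2+m≤k r promising i r′ with i ≤? slack m
    ... | yes i≤s =
      ⊥-elim (above-slack 2+m≤k (promising _ (split x ε x∈ θx r (SplitRef-weaken (m≤n⇒m≤1+n i≤s) r′))))
    ... | no  i≰s with ≰⇒> i≰s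
    ...   | s≤s s≤i′ = promising _ (split x ε x∈ θx (SplitRef-weaken s≤i′ r) r′)

    defuse : ∀ θ m {x ε} → x ∈ vars F → val θ x ≡ nothing → suc (suc m) ≤ k →
             SplitRef (slack m) (θ [ x ≔ ε ]) → Good θ m → Good (θ [ x ≔ not ε ]) m
    defuse θ m {x} {ε} x∈ θx 2+m≤k r good = record
      { within    = VarsIn-[≔] θ (not ε) within x∈
      ; promising = dodge θ m x∈ θx 2+m≤k r promising
      ; refutable = let j , rⱼ = refutable in j , SplitRef-mono (⊑-[≔] θ x (not ε) θx) rⱼ
      }
      where open Good good

    stabilize : ∀ n θ m → unassigned θ ≤ n → Good θ m →
                ∃ λ θ′ → θ ⊑ θ′ × Good θ′ m × Stable θ′ m × unassigned θ′ ≤ unassigned θ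
    stabilize n θ m fuel good with ∃∈? (vars F) (Dangerous θ m) (λ {x} _ → Dangerous? θ m x)
    ... | no ¬danger = θ , ⊑-refl θ , good , stable , ≤-refl
      where
      stable : Stable θ m
      stable {x} x∈ θx ε i r with k ≤? suc m + i
      ... | yes k≤ = k≤
      ... | no  k≰ with 2+m≤k , i≤s ← below-slack k≰ =
        ⊥-elim (¬danger (x , x∈ , θx , 2+m≤k , ε , SplitRef-weaken i≤s r))
    ... | yes (x , x∈ , θx , 2+m≤k , ε , r) with n
    ...   | zero = ⊥-elim (out-of-fuel θ x∈ θx fuel)
    ...   | suc n′ =
      let θ′ , θ₁⊑θ′ , good′ , stable′ , fewer =
            stabilize n′ (θ [ x ≔ not ε ]) m (fuel-[≔] θ (not ε) x∈ θx fuel) (defuse θ m x∈ θx 2+m≤k r good)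
      in θ′ , ⊑-trans θ (θ [ x ≔ not ε ]) θ′ (⊑-[≔] θ x (not ε) θx) θ₁⊑θ′ , good′ , stable′ ,
         ≤-trans fewer (<⇒≤ (unassigned-[≔] θ (not ε) x∈ θx))

    -- Delayer, to move at θ, replaces θ by a stabilisation of some good φ ⊒ θ.
    mutual
      delayer-to-move : ∀ n θ φ m → θ ⊑ φ → unassigned φ ≤ n → Good φ m → DelayerGuarD F k θ m
      delayer-to-move n θ φ m θ⊑φ fuel good with status θ
      ... | ⊥-reached ⊥∈ = endBot ⊥∈ (reached-⊥ (Good.promising good) (⊥∈*-mono θ φ F θ⊑φ ⊥∈))
      ... | ⊤-reached ⊤∈ = ⊥-elim (SplitRef⇒¬top (proj₂ (Good.refutable good)) (*≡[]-mono θ φ F θ⊑φ ⊤∈))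
      ... | running ¬end with θ′ , φ⊑θ′ , good′ , stable′ , fewer ← stabilize n φ m fuel good =
        move ¬end θ′ (⊑-trans θ φ θ′ θ⊑φ φ⊑θ′) (Good.within good′)
             (prover-to-move n θ′ m (≤-trans fewer fuel) good′ stable′)

      prover-to-move : ∀ n θ m → unassigned θ ≤ n → Good θ m → Stable θ m → DelayerGuarP F k θ m
      prover-to-move n θ m fuel good stable with status θ
      ... | ⊥-reached ⊥∈ = endBot ⊥∈ (reached-⊥ (Good.promising good) ⊥∈)
      ... | ⊤-reached ⊤∈ = ⊥-elim (SplitRef⇒¬top (proj₂ (Good.refutable good)) ⊤∈)
      ... | running ¬end = move ¬end (answer n θ m fuel good stable)

      answer : ∀ n θ m → unassigned θ ≤ n → Good θ m → Stable θ m →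
               ∀ θ′ → ProverMove F θ θ′ → VarsIn θ′ F → DelayerGuarD F k θ′ (suc m)
      answer n θ m fuel good stable θ′ ((θ⊑θ′ , _) , inj₁ ⊤∈) _ =
        ⊥-elim (SplitRef⇒¬top (SplitRef-mono θ⊑θ′ (proj₂ (Good.refutable good))) ⊤∈)
      answer zero θ m fuel good stable θ′ (_ , inj₂ (_ , v , θv , θ′v , _)) θ′⊆F =
        ⊥-elim (out-of-fuel θ (∈vars⁺ F (θ′⊆F v θ′v)) θv fuel)
      answer (suc n) θ m fuel good stable θ′ (_ , inj₂ (θ⊑θ′ , v , θv , θ′v , others)) θ′⊆F =
        delayer-to-move n θ′ θ′ (suc m) (⊑-refl θ′) fuel′ good′
        where
        v∈ : v ∈ vars F
        v∈ = ∈vars⁺ F (θ′⊆F v θ′v)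
        fuel′ : unassigned θ′ ≤ n
        fuel′ = ≤-pred (≤-trans (unassigned-< θ θ′ θ⊑θ′ v∈ θv θ′v) fuel)
        good′ : Good θ′ (suc m)
        good′ with b , θ′v≡b ← assigned⇒just {θ′} θ′v = record
          { within    = θ′⊆F
          ; promising = λ i r → stable v∈ θv b i (SplitRef-mono (only-v-changed⇒⊑[≔] θ θ′ v b others θ′v≡b) r)
          ; refutable = let j , r = Good.refutable good in j , SplitRef-mono θ⊑θ′ r
          }

    delayer-wins : IsHd F k → DelayerGuarD F k emptyPA 0
    delayer-wins (inj₁ (F≡[] , k≡0)) = endTop (cong (emptyPA *_) F≡[]) (≤-reflexive k≡0)
    delayer-wins (inj₂ (_ , (φ , hd) , _)) = delayer-to-move _ emptyPA φ′ 0 (λ _ _ ()) ≤-refl good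
      where
      φ′ = restrictVars φ
      hd′ : HdUnsat (φ′ * F) k
      hd′ = subst (λ G → HdUnsat G k) (restrictVars-* φ) hd
      refutable : Refutable φ′
      refutable with top⊎satisfiable⊎refutable _ φ′ ≤-refl (restrictVars-VarsIn φ)
      ... | inj₁ ⊤∈ = ⊥-elim (unsat⇒≢[] (proj₁ hd′) ⊤∈)
      ... | inj₂ (inj₁ (ψ , (φ′⊑ψ , _) , ⊤∈ , _)) = ⊥-elim (proj₁ hd′ ψ (*-reduced-≡[] φ′ ψ F φ′⊑ψ ⊤∈))
      ... | inj₂ (inj₂ r) = r
      good : Good φ′ 0
      good = record
        { within    = restrictVars-VarsIn φ
        ; promising = λ _ → HdUnsat-≤-SplitRef cs hd′
        ; refutable = refutable
        }

    mutual
      prover-follows : ∀ j θ m → SplitRef j θ → m + j ≤ k → ProverLimD F k θ m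
      prover-follows j θ m r m+j≤k with status θ
      ... | ⊥-reached ⊥∈ = endBot ⊥∈ (m+n≤o⇒m≤o m m+j≤k)
      ... | ⊤-reached ⊤∈ = endTop ⊤∈
      ... | running ¬end = move ¬end λ θ′ θ⊑θ′ θ′⊆F → prover-splits j θ′ m (SplitRef-mono θ⊑θ′ r) m+j≤k θ′⊆F

      prover-splits : ∀ j θ m → SplitRef j θ → m + j ≤ k → VarsIn θ F → ProverLimP F k θ m
      prover-splits j θ m r m+j≤k θ⊆F with status θ | r
      ... | ⊥-reached ⊥∈ | _ = endBot ⊥∈ (m+n≤o⇒m≤o m m+j≤k)
      ... | ⊤-reached ⊤∈ | _ = endTop ⊤∈
      ... | running ¬end | falsified ⊥∈ = ⊥-elim (¬end (inj₁ ⊥∈))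
      ... | running ¬end | split {i} x ε x∈ θx r₀ _ =
        move ¬end (θ [ x ≔ ε ]) ([≔]-ProverMove θ x ε θx) (VarsIn-[≔] θ ε θ⊆F x∈)
             (prover-follows i _ (suc m) r₀ (subst (_≤ k) (+-suc m i) m+j≤k))

    prover-opening : IsHd F k → ∀ θ → emptyPA ⊑ θ → VarsIn θ F → ProverLimP F k θ 0
    prover-opening hd θ _ θ⊆F with status θ | top⊎satisfiable⊎refutable _ θ ≤-refl θ⊆F
    ... | ⊥-reached ⊥∈ | _ = endBot ⊥∈ z≤n
    ... | ⊤-reached ⊤∈ | _ = endTop ⊤∈
    ... | running ¬end | inj₁ ⊤∈ = endTop ⊤∈
    ... | running ¬end | inj₂ (inj₁ (ψ , θ⊏ψ , ⊤∈ , ψ⊆F)) = move ¬end ψ (θ⊏ψ , inj₁ ⊤∈) ψ⊆F (endTop ⊤∈)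
    ... | running ¬end | inj₂ (inj₂ (j , r)) with j₀ , r₀ , hd₀ ← SplitRef⇒hd cs r =
      prover-splits j₀ θ 0 r₀ (IsHd-maximal hd hd₀) θ⊆F

    prover-caps : IsHd F k → ProverLimD F k emptyPA 0
    prover-caps hd with status emptyPA
    ... | ⊥-reached ⊥∈ = endBot ⊥∈ z≤n
    ... | ⊤-reached ⊤∈ = endTop ⊤∈
    ... | running ¬end = move ¬end (prover-opening hd)

theorem4p7 : (F : CSet) → IsClauseSet F → (k : ℕ) → IsHd F k →
    DelayerGuarD F k emptyPA 0 × ProverLimD F k emptyPA 0
theorem4p7 F cs k hd = delayer-wins hd , prover-caps hd
  where open Strategies F cs k
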